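{- Let $P$ be a finite graded poset with nonempty levels $L(0),\dots,L(n-1)$, $N(i)=|L(i)|$, and let $f$ be a scaled normalized matching flow of $P$. Extend $P$ and $f$ to $\hat P$ with bottom element $0$ and top element $1$ and define the weights $\phi$ as below. Then for every $i\in\{0,\dots,n-1\}$ and every $x\in L(i)$: (1) $\phi([0,x])=\frac{1}{N(i)}$, and (2) $\phi([x,1])=1$.
   Context: A poset is graded if it has a rank function $r$ with $r(x)=0$ for minimal $x$ and $r(y)=r(x)+1$ whenever $y$ covers $x$; $L(i)=\{x:r(x)=i\}$. A scaled normalized matching flow (SNMF) of $P$ is a function $f$ from the cover-graph edges to $\mathbb{R}_{\geq0}$ such that for each $i\leq n-2$: every $x\in L(i)$ has $\sum_{y\text{ covers }x}f(xy)=1$, and every $y\in L(i+1)$ has $\sum_{x\text{ covered by }y}f(xy)=N(i)/N(i+1)$. Construction of $\hat P$: if $P$ has a unique minimum, call it $0$; otherwise adjoin a new element $0$ covered by every element of $L(0)$ and set $f(0x)=1/N(0)$ for $x\in L(0)$. Similarly, if $P$ has a unique maximum, call it $1$; otherwise adjoin a new element $1$ covering every element of $L(n-1)$ and set $f(x1)=1$ for $x\in L(n-1)$. A chain $C$ of $\hat P$ is skipless if the set of levels it meets is an interval (new elements count as levels $-1$ and $n$). For a skipless chain $C=\{x_0\prec\dots\prec x_k\}$ set $\phi(C)=\prod_{i=0}^{k-1}f(x_ix_{i+1})$ (so $\phi(C)=1$ if $|C|=1$). For $x\preceq y$, $[x,y]$ is the set of skipless chains with minimum $x$ and maximum $y$,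 and $\phi([x,y])=\sum_{C\in[x,y]}\phi(C)$. -}

module Defs where

open import Data.Bool using (Bool; true; false; T; _∧_; _∨_; not; if_then_else_)
open import Data.Nat as ℕ using (ℕ; zero; suc; _≡ᵇ_; _≤ᵇ_; _∸_)
open import Data.Integer using (+_)
open import Data.Fin using (Fin)
open import Data.Fin.Properties using () renaming (_≟_ to _≟ᶠ_)
open import Data.List using (List; []; _∷_; _++_; map; foldr; filter; filterᵇ; length; concatMap; upTo)
open import Data.Bool.ListAction using (all; any)
open import Data.Maybe using (Maybe; just; nothing; maybe)
open import Data.List.Base using (allFin)
open import Data.Rational using (ℚ; 0ℚ; 1ℚ; _+_; _*_; _/_) renaming (_≤_ to _≤ℚ_)
open import Relation.Binary.PropositionalEquality using (_≡_)
open import Relation.Nullary.Decidable using (⌊_⌋)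

record FinPoset (m : ℕ) : Set where
  field
    le      : Fin m → Fin m → Bool
    reflexive : ∀ x → T (le x x)
    antisym : ∀ x y → T (le x y) → T (le y x) → x ≡ y
    trans   : ∀ x y z → T (le x y) → T (le y z) → T (le x z)

module _ {m : ℕ} (P : FinPoset m) where
  open FinPoset P

  eqᶠ : Fin m → Fin m → Bool
  eqᶠ x y = ⌊ x ≟ᶠ y ⌋

  lt : Fin m → Fin m → Bool
  lt x y = le x y ∧ not (eqᶠ x y)

  coversB : Fin m → Fin m → Bool
  coversB x y = lt x y ∧ not (any (λ z → lt x z ∧ lt z y) (allFin m))

  Covers : Fin m → Fin m → Set
  Covers x y = T (coversB x y)

  Minimal : Fin m → Set
  Minimal x = ∀ y → T (le y x) → y ≡ x

  record IsGraded (r : Fin m → ℕ) : Set where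
    field
      minimal⇒0 : ∀ x → Minimal x → r x ≡ 0
      cover⇒suc : ∀ x y → Covers x y → r y ≡ suc (r x)

-- Sums of rationals, and a "safe" fraction a/b (b ≠ 0 whenever used).

sumℚ : List ℚ → ℚ
sumℚ = foldr _+_ 0ℚ

frac : ℕ → ℕ → ℚ
frac a zero    = 0ℚ
frac a (suc b) = (+ a) / suc b

module _ {m : ℕ} (P : FinPoset m) (r : Fin m → ℕ) where
  open FinPoset P

  level : ℕ → List (Fin m)
  level i = filter (λ x → r x ℕ.≟ i) (allFin m)

  N : ℕ → ℕ
  N i = length (level i)

  -- Scaled normalized matching flow (f is given on all pairs; only its
  -- values on cover edges matter).
  record IsSNMF (n : ℕ) (f : Fin m → Fin m → ℚ) : Set where
    field
      nonneg : ∀ x y → Covers P x y → 0ℚ ≤ℚ f x y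
      up     : ∀ i x → suc (suc i) ℕ.≤ n → r x ≡ i →
               sumℚ (map (f x) (filterᵇ (coversB P x) (allFin m))) ≡ 1ℚ
      down   : ∀ i y → suc (suc i) ℕ.≤ n → r y ≡ suc i →
               sumℚ (map (λ x → f x y) (filterᵇ (λ x → coversB P x y) (allFin m)))
                 ≡ frac (N i) (N (suc i))

-- The extension P̂.  Carrier candidates: a new bottom ⊥̂, the elements
-- ι x of P, and a new top ⊤̂.  ⊥̂ (resp. ⊤̂) belongs to P̂ only if P has
-- no unique minimum (resp. maximum).

data Ĥ (m : ℕ) : Set where
  ⊥̂ : Ĥ m
  ι : Fin m → Ĥ m
  ⊤̂ : Ĥ m

findᵇ : {A : Set} → (A → Bool) → List A → Maybe A
findᵇ p []       = nothing
findᵇ p (a ∷ as) = if p a then just a else findᵇ p as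

module Hat {m : ℕ} (P : FinPoset m) (r : Fin m → ℕ) (n : ℕ)
           (f : Fin m → Fin m → ℚ) where
  open FinPoset P

  minimumP : Maybe (Fin m)
  minimumP = findᵇ (λ x → all (λ y → le x y) (allFin m)) (allFin m)

  maximumP : Maybe (Fin m)
  maximumP = findᵇ (λ x → all (λ y → le y x) (allFin m)) (allFin m)

  0̂ : Ĥ m
  0̂ = maybe ι ⊥̂ minimumP

  1̂ : Ĥ m
  1̂ = maybe ι ⊤̂ maximumP

  hasNewBot : Bool
  hasNewBot = maybe (λ _ → false) true minimumP

  hasNewTop : Bool
  hasNewTop = maybe (λ _ → false) true maximumP

  inP̂ : Ĥ m → Bool
  inP̂ ⊥̂     = hasNewBot
  inP̂ (ι _) = true
  inP̂ ⊤̂     = hasNewTop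

  elemsP̂ : List (Ĥ m)
  elemsP̂ = filterᵇ inP̂ (⊥̂ ∷ map ι (allFin m) ++ ⊤̂ ∷ [])

  eqĤ : Ĥ m → Ĥ m → Bool
  eqĤ ⊥̂ ⊥̂ = true
  eqĤ (ι x) (ι y) = eqᶠ P x y
  eqĤ ⊤̂ ⊤̂ = true
  eqĤ _ _ = false

  leĤ : Ĥ m → Ĥ m → Bool
  leĤ ⊥̂ _ = true
  leĤ _ ⊤̂ = true
  leĤ (ι x) (ι y) = le x y
  leĤ _ _ = false

  ltĤ : Ĥ m → Ĥ m → Bool
  ltĤ a b = leĤ a b ∧ not (eqĤ a b)

  -- levels of P̂, shifted by one: ⊥̂ at 0 (i.e. level -1), ι x at r x + 1,
  -- ⊤̂ at n + 1 (i.e. level n).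
  rk : Ĥ m → ℕ
  rk ⊥̂     = 0
  rk (ι x) = suc (r x)
  rk ⊤̂     = suc n

  f̂ : Ĥ m → Ĥ m → ℚ
  f̂ ⊥̂ (ι _)     = frac 1 (N P r 0)
  f̂ (ι x) (ι y) = f x y
  f̂ (ι _) ⊤̂     = 1ℚ
  f̂ _ _         = 0ℚ

  -- a chain is represented by the increasing list of its elements
  increasing : List (Ĥ m) → Bool
  increasing []           = true
  increasing (a ∷ [])     = true
  increasing (a ∷ b ∷ cs) = ltĤ a b ∧ increasing (b ∷ cs)

  minLevel maxLevel : List (Ĥ m) → ℕ
  minLevel = foldr (λ c k → rk c ℕ.⊓ k) (suc (suc n))
  maxLevel = foldr (λ c k → rk c ℕ.⊔ k) 0

  -- the set of levels met by C is an interval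
  skipless : List (Ĥ m) → Bool
  skipless C = all (λ l → not ((minLevel C ≤ᵇ l) ∧ (l ≤ᵇ maxLevel C))
                           ∨ any (λ c → rk c ≡ᵇ l) C)
                   (upTo (suc (suc n)))

  headIs lastIs : Ĥ m → List (Ĥ m) → Bool
  headIs a []      = false
  headIs a (c ∷ _) = eqĤ a c
  lastIs a []           = false
  lastIs a (c ∷ [])     = eqĤ a c
  lastIs a (c ∷ d ∷ cs) = lastIs a (d ∷ cs)

  lists : ℕ → List (List (Ĥ m))
  lists zero    = [] ∷ []
  lists (suc k) = concatMap (λ a → map (a ∷_) (lists k)) elemsP̂

  -- all skipless chains of P̂ with minimum a and maximum b
  -- (a chain of P̂ has at most m + 2 elements)
  interval : Ĥ m → Ĥ m → List (List (Ĥ m))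
  interval a b = filterᵇ (λ C → increasing C ∧ skipless C ∧ headIs a C ∧ lastIs b C)
                         (concatMap lists (upTo (suc (suc (suc m)))))

  φC : List (Ĥ m) → ℚ
  φC []           = 1ℚ
  φC (a ∷ [])     = 1ℚ
  φC (a ∷ b ∷ cs) = f̂ a b * φC (b ∷ cs)

  φ : Ĥ m → Ĥ m → ℚ
  φ a b = sumℚ (map φC (interval a b))

-- In P̂ an increasing list is skipless exactly when each element lies one level above its
-- predecessor, so φ([a, b]) is the total weight of the paths from a to b that climb one level
-- per step.  Splitting off the last step of a path from 0 and using the down-condition turns the
-- weight 1/N(i) of each element of level i into (1/N(i))·(N(i)/N(i+1)) = 1/N(i+1) one level
-- higher; splitting off the first step of a path to 1 and using the up-condition carries the
-- weight 1 from level i+1 down to level i.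

module Submission where

open import Algebra.Bundles using (CommutativeSemiring; CommutativeRing)
open import Data.Bool using (Bool; true; false; T; not; _∧_; _∨_; if_then_else_)
open import Data.Bool.ListAction using (all; any)
open import Data.Bool.Properties using (T-≡; T-∧; if-∧; if-eta; ∧-assoc; ∧-zeroʳ)
open import Data.Empty using (⊥-elim)
open import Data.Fin using (Fin; toℕ)
open import Data.Fin.Properties using (toℕ-injective; toℕ<n; injective⇒≤) renaming (_≟_ to _≟ᶠ_)
open import Data.Fin.Subset as Subset using (Subset; ∣_∣)
open import Data.Fin.Subset.Properties using (p⊂q⇒∣p∣<∣q∣)
open import Data.Integer using (+_)
import Data.Integer.Properties as ℤ
open import Data.List using (List; []; _∷_; _++_; map; foldr; filterᵇ; concatMap; length; allFin; upTo)
open import Data.List.Membership.Propositional using (_∈_)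
open import Data.List.Membership.Propositional.Properties
  using (∈-allFin; ∈-filter⁺; ∈-filter⁻; ∈-upTo⁺; ∈-map⁺; ∈-map⁻; ∈-++⁺ˡ; ∈-++⁺ʳ)
open import Data.List.Relation.Unary.All as All using (All; _∷_)
import Data.List.Relation.Unary.All.Properties as Allₚ
open import Data.List.Relation.Unary.Any as Any using (Any; here; there)
open import Data.List.Relation.Unary.Any.Properties using (any⁺; any⁻)
open import Data.List.Relation.Unary.Unique.Propositional using (Unique; []; _∷_)
import Data.List.Relation.Unary.Unique.Propositional.Properties as Unique
open import Data.Maybe using (just; nothing; maybe)
open import Data.Nat using (ℕ; zero; suc; _∸_; _≤_; _<_; _≡ᵇ_; _≤ᵇ_; _⊓_; z≤n; s≤s)
import Data.Nat.Properties as ℕ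
open import Data.Product using (_×_; _,_; proj₁; proj₂; ∃)
open import Data.Product.Function.NonDependent.Propositional using (_×-⇔_)
open import Data.Rational using (ℚ; 0ℚ; 1ℚ; toℚᵘ)
import Data.Rational.Properties as ℚ
open import Data.Rational.Unnormalised using (mkℚᵘ; *≡*) renaming (_*_ to _*ᵘ_)
import Data.Rational.Unnormalised.Properties as ℚᵘ
open import Data.Sum using (_⊎_; inj₁; inj₂)
open import Data.Unit using (tt)
import Data.Vec as Vec
import Data.Vec.Properties as Vecₚ
open import Function using (_∘_; _⇔_; mk⇔; Equivalence)
import Function.Properties.Equivalence as Equiv
open import Level using (0ℓ)
open import Relation.Binary.PropositionalEquality
import Relation.Binary.Reasoning.Setoid as SetoidReasoning
open import Relation.Nullary using (¬_; yes; no)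
open import Relation.Nullary.Decidable using (⌊_⌋; T?; toWitness; fromWitness)

open import Defs

module ListSum {c ℓ} (R : CommutativeSemiring c ℓ) where
  open CommutativeSemiring R
    renaming (refl to ≈-refl; sym to ≈-sym; trans to ≈-trans)
  open import Algebra.Properties.CommutativeSemigroup +-commutativeSemigroup using (interchange)

  ∑ : ∀ {a} {A : Set a} → List A → (A → Carrier) → Carrier
  ∑ xs g = foldr _+_ 0# (map g xs)

  module _ {a} {A : Set a} where

    ∑-cong : ∀ xs {g h : A → Carrier} → (∀ {x} → x ∈ xs → g x ≈ h x) → ∑ xs g ≈ ∑ xs h
    ∑-cong []       e = ≈-refl
    ∑-cong (x ∷ xs) e = +-cong (e (here refl)) (∑-cong xs (e ∘ there))

    ∑-zero : ∀ xs {g : A → Carrier} → (∀ {x} → x ∈ xs → g x ≈ 0#) → ∑ xs g ≈ 0#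
    ∑-zero []       e = ≈-refl
    ∑-zero (x ∷ xs) e = ≈-trans (+-cong (e (here refl)) (∑-zero xs (e ∘ there))) (+-identityˡ 0#)

    ∑-++ : ∀ xs ys (g : A → Carrier) → ∑ (xs ++ ys) g ≈ ∑ xs g + ∑ ys g
    ∑-++ []       ys g = ≈-sym (+-identityˡ _)
    ∑-++ (x ∷ xs) ys g = ≈-trans (+-congˡ (∑-++ xs ys g)) (≈-sym (+-assoc _ _ _))

    ∑-distrib-+ : ∀ xs (g h : A → Carrier) → ∑ xs (λ x → g x + h x) ≈ ∑ xs g + ∑ xs h
    ∑-distrib-+ []       g h = ≈-sym (+-identityˡ _)
    ∑-distrib-+ (x ∷ xs) g h = ≈-trans (+-congˡ (∑-distrib-+ xs g h)) (≈-sym (interchange _ _ _ _))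

    *-distribˡ-∑ : ∀ xs q (g : A → Carrier) → q * ∑ xs g ≈ ∑ xs (λ x → q * g x)
    *-distribˡ-∑ []       q g = zeroʳ q
    *-distribˡ-∑ (x ∷ xs) q g = ≈-trans (distribˡ q _ _) (+-congˡ (*-distribˡ-∑ xs q g))

    *-distribʳ-∑ : ∀ xs q (g : A → Carrier) → ∑ xs g * q ≈ ∑ xs (λ x → g x * q)
    *-distribʳ-∑ []       q g = zeroˡ q
    *-distribʳ-∑ (x ∷ xs) q g = ≈-trans (distribʳ q _ _) (+-congˡ (*-distribʳ-∑ xs q g))

    ∑-filterᵇ : ∀ xs (p : A → Bool) (g : A → Carrier) →
                ∑ (filterᵇ p xs) g ≈ ∑ xs (λ x → if p x then g x else 0#)
    ∑-filterᵇ []       p g = ≈-refl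
    ∑-filterᵇ (x ∷ xs) p g with p x
    ... | true  = +-congˡ (∑-filterᵇ xs p g)
    ... | false = ≈-trans (∑-filterᵇ xs p g) (≈-sym (+-identityˡ _))

    ∑-map : ∀ {b} {B : Set b} xs (k : B → A) (g : A → Carrier) → ∑ (map k xs) g ≈ ∑ xs (g ∘ k)
    ∑-map []       k g = ≈-refl
    ∑-map (x ∷ xs) k g = +-congˡ (∑-map xs k g)

    ∑-concatMap : ∀ {b} {B : Set b} xs (k : B → List A) (g : A → Carrier) →
                  ∑ (concatMap k xs) g ≈ ∑ xs (λ x → ∑ (k x) g)
    ∑-concatMap []       k g = ≈-refl
    ∑-concatMap (x ∷ xs) k g = ≈-trans (∑-++ (k x) (concatMap k xs) g) (+-congˡ (∑-concatMap xs k g))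

    ∑-δ : ∀ {xs x} (g : A → Carrier) → Unique xs → x ∈ xs → (∀ y → y ≢ x → g y ≈ 0#) → ∑ xs g ≈ g x
    ∑-δ {x ∷ xs} g (x∉xs ∷ _) (here refl) vanish =
      ≈-trans (+-congˡ (∑-zero xs (λ y∈xs → vanish _ (λ { refl → All.lookup x∉xs y∈xs refl })))) (+-identityʳ _)
    ∑-δ {y ∷ xs} g (y∉xs ∷ u) (there x∈xs) vanish =
      ≈-trans (+-congʳ (vanish y (λ { refl → All.lookup y∉xs x∈xs refl })))
              (≈-trans (+-identityˡ _) (∑-δ g u x∈xs vanish))

  ∑-comm : ∀ {a b} {A : Set a} {B : Set b} xs ys (g : A → B → Carrier) →
           ∑ xs (λ x → ∑ ys (g x)) ≈ ∑ ys (λ y → ∑ xs (λ x → g x y))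
  ∑-comm []       ys g = ≈-sym (∑-zero ys (λ _ → ≈-refl))
  ∑-comm (x ∷ xs) ys g = ≈-trans (+-congˡ (∑-comm xs ys g)) (≈-sym (∑-distrib-+ ys (g x) _))

open ListSum (CommutativeRing.commutativeSemiring ℚ.+-*-commutativeRing)
open Data.Nat using (_+_)
open Data.Rational using (_*_) renaming (_+_ to _+ℚ_)
open Equivalence using (to; from)

T-injective : ∀ {a b} → T a ⇔ T b → a ≡ b
T-injective {false} {false} _   = refl
T-injective {false} {true}  a⇔b = ⊥-elim (from a⇔b tt)
T-injective {true}  {false} a⇔b = ⊥-elim (to a⇔b tt)
T-injective {true}  {true}  _   = refl

T-not-∨ : ∀ {a b} → T (not a ∨ b) ⇔ (T a → T b)
T-not-∨ {false} = mk⇔ (λ _ ()) (λ _ → tt)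
T-not-∨ {true}  = mk⇔ (λ b _ → b) (λ g → g tt)

if-T : ∀ {a} {A : Set a} {b} {x y : A} → T b → (if b then x else y) ≡ x
if-T {b = true} _ = refl

if-¬T : ∀ {a} {A : Set a} {b} {x y : A} → ¬ T b → (if b then x else y) ≡ y
if-¬T {b = false} _  = refl
if-¬T {b = true}  ¬t = ⊥-elim (¬t tt)

≡ᵇ⇔≡ : ∀ {m n} → T (m ≡ᵇ n) ⇔ m ≡ n
≡ᵇ⇔≡ = mk⇔ (ℕ.≡ᵇ⇒≡ _ _) (ℕ.≡⇒≡ᵇ _ _)

if-∧-* : ∀ s t {x y : ℚ} → (if s ∧ t then x * y else 0ℚ) ≡ (if s then x else 0ℚ) * (if t then y else 0ℚ)
if-∧-* false t     {y = y} = sym (ℚ.*-zeroˡ (if t then y else 0ℚ))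
if-∧-* true  false {x}     = sym (ℚ.*-zeroʳ x)
if-∧-* true  true          = refl

∧-pull : ∀ i s h l → i ∧ (s ∧ (h ∧ l)) ≡ h ∧ ((i ∧ s) ∧ l)
∧-pull true  true  h l = refl
∧-pull true  false h l = sym (∧-zeroʳ h)
∧-pull false s     h l = sym (∧-zeroʳ h)

findᵇ-just : ∀ {A : Set} (p : A → Bool) xs {z} → findᵇ p xs ≡ just z → T (p z)
findᵇ-just p (x ∷ xs) found with p x in px
findᵇ-just p (x ∷ xs) refl  | true  = from T-≡ px
...                         | false = findᵇ-just p xs found

length≡1 : ∀ {a} {A : Set a} {xs : List A} {x} →
           Unique xs → x ∈ xs → (∀ {y} → y ∈ xs → y ≡ x) → length xs ≡ 1
length≡1 {xs = _ ∷ []}    _                  _ _    = refl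
length≡1 {xs = _ ∷ _ ∷ _} ((a≢b ∷ _) ∷ _) _ only =
  ⊥-elim (a≢b (trans (only (here refl)) (sym (only (there (here refl))))))

∈-tabulate⇔ : ∀ {k} {g : Fin k → Bool} {i} → i Subset.∈ Vec.tabulate g ⇔ T (g i)
∈-tabulate⇔ {g = g} {i} = mk⇔
  (λ i∈ → from T-≡ (trans (sym (Vecₚ.lookup∘tabulate g i)) (Vecₚ.[]=⇒lookup i∈)))
  (λ gi → Vecₚ.lookup⇒[]= i _ (trans (Vecₚ.lookup∘tabulate g i) (to T-≡ gi)))

module Order {m} (P : FinPoset m) where
  open FinPoset P renaming (trans to le-trans)

  IsMinimum IsMaximum : Fin m → Set
  IsMinimum z = ∀ y → T (le z y)
  IsMaximum z = ∀ y → T (le y z)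

  not-eqᶠ⇔≢ : ∀ {x y : Fin m} → T (not ⌊ x ≟ᶠ y ⌋) ⇔ x ≢ y
  not-eqᶠ⇔≢ {x} {y} with x ≟ᶠ y
  ... | yes refl = mk⇔ (λ ()) (λ x≢x → x≢x refl)
  ... | no x≢y   = mk⇔ (λ _ → x≢y) (λ _ → tt)

  lt⇔ : ∀ {x y} → T (lt P x y) ⇔ (T (le x y) × x ≢ y)
  lt⇔ {x} {y} = mk⇔
    (λ x<y → let x≤y , x≉y = to (T-∧ {le x y}) x<y in x≤y , to (not-eqᶠ⇔≢ {x}) x≉y)
    (λ (x≤y , x≢y) → from T-∧ (x≤y , from (not-eqᶠ⇔≢ {x}) x≢y))

  lt-irrefl : ∀ {x} → ¬ T (lt P x x)
  lt-irrefl x<x = proj₂ (to lt⇔ x<x) refl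

  lt-trans : ∀ {x y z} → T (lt P x y) → T (lt P y z) → T (lt P x z)
  lt-trans {x} {y} {z} x<y y<z =
    let x≤y , _ = to lt⇔ x<y ; y≤z , y≢z = to lt⇔ y<z in
    from lt⇔ (le-trans x y z x≤y y≤z , λ { refl → y≢z (antisym y x y≤z x≤y) })

  covers-or-between : ∀ {x y} → T (lt P x y) → Covers P x y ⊎ ∃ λ z → T (lt P x z) × T (lt P z y)
  covers-or-between {x} {y} x<y with any (λ z → lt P x z ∧ lt P z y) (allFin m) in e
  ... | false = inj₁ (from T-∧ (x<y , tt))
  ... | true  = let z , x<z<y = Any.satisfied (any⁻ _ (allFin m) (from T-≡ e)) in
                inj₂ (z , to T-∧ x<z<y)

  strictlyBetween : Fin m → Fin m → Subset m
  strictlyBetween x y = Vec.tabulate (λ z → lt P x z ∧ lt P z y)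

  ∈-strictlyBetween⇔ : ∀ {x y z} → z Subset.∈ strictlyBetween x y ⇔ (T (lt P x z) × T (lt P z y))
  ∈-strictlyBetween⇔ {x} {y} {z} =
    mk⇔ (to (T-∧ {lt P x z}) ∘ to ∈-tabulate⇔) (from ∈-tabulate⇔ ∘ from (T-∧ {lt P x z}))

  strictlyBetween-⊂ˡ : ∀ {x y z} → T (lt P x z) → T (lt P z y) →
                       strictlyBetween x z Subset.⊂ strictlyBetween x y
  strictlyBetween-⊂ˡ x<z z<y =
    (λ w∈ → let x<w , w<z = to ∈-strictlyBetween⇔ w∈ in from ∈-strictlyBetween⇔ (x<w , lt-trans w<z z<y))
    , _ , from ∈-strictlyBetween⇔ (x<z , z<y) , λ z∈ → lt-irrefl (proj₂ (to ∈-strictlyBetween⇔ z∈))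

  strictlyBetween-⊂ʳ : ∀ {x y z} → T (lt P x z) → T (lt P z y) →
                       strictlyBetween z y Subset.⊂ strictlyBetween x y
  strictlyBetween-⊂ʳ x<z z<y =
    (λ w∈ → let z<w , w<y = to ∈-strictlyBetween⇔ w∈ in from ∈-strictlyBetween⇔ (lt-trans x<z z<w , w<y))
    , _ , from ∈-strictlyBetween⇔ (x<z , z<y) , λ z∈ → lt-irrefl (proj₁ (to ∈-strictlyBetween⇔ z∈))

module Levels {m} (P : FinPoset m) (r : Fin m → ℕ) where

  ∈-level : ∀ {x i} → r x ≡ i → x ∈ level P r i
  ∈-level {x} {i} = ∈-filter⁺ (λ x → r x ℕ.≟ i) {xs = allFin m} (∈-allFin x)

  N-pos : ∀ {x i} → r x ≡ i → 0 < length (level P r i)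
  N-pos {i = i} rx≡i with level P r i | ∈-level rx≡i
  ... | _ ∷ _ | _ = s≤s z≤n

  N≡1 : ∀ {z i} → r z ≡ i → (∀ y → r y ≡ i → y ≡ z) → N P r i ≡ 1
  N≡1 rz≡i only = length≡1 (Unique.filter⁺ _ (Unique.allFin⁺ m)) (∈-level rz≡i)
                           (λ y∈ → only _ (proj₂ (∈-filter⁻ (λ x → r x ℕ.≟ _) {xs = allFin m} y∈)))

  levels⇒n≤m : ∀ {n} → (∀ i → i < n → ∃ λ x → r x ≡ i) → n ≤ m
  levels⇒n≤m {n} lev = injective⇒≤ {f = witness} λ {i} {j} e →
    toℕ-injective (trans (sym (proj₂ (lev _ _))) (trans (cong r e) (proj₂ (lev _ _))))
    where
    witness : Fin n → Fin m
    witness i = proj₁ (lev (toℕ i) (toℕ<n i))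

module Graded {m} (P : FinPoset m) (r : Fin m → ℕ) (graded : IsGraded P r) where
  open FinPoset P using (le; antisym)
  open Order P
  open IsGraded graded

  rank-< : ∀ {x y} → T (lt P x y) → r x < r y
  rank-< = descend (suc ∣ strictlyBetween _ _ ∣) ℕ.≤-refl
    where
    descend : ∀ k {x y} → ∣ strictlyBetween x y ∣ < k → T (lt P x y) → r x < r y
    descend (suc k) {x} {y} bound x<y with covers-or-between x<y
    ... | inj₁ x⋖y = ℕ.≤-reflexive (sym (cover⇒suc x y x⋖y))
    ... | inj₂ (z , x<z , z<y) = ℕ.<-trans
      (descend k (ℕ.<-≤-trans (p⊂q⇒∣p∣<∣q∣ (strictlyBetween-⊂ˡ x<z z<y)) (ℕ.≤-pred bound)) x<z)
      (descend k (ℕ.<-≤-trans (p⊂q⇒∣p∣<∣q∣ (strictlyBetween-⊂ʳ x<z z<y)) (ℕ.≤-pred bound)) z<y)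

  le∧rank≡⇒≡ : ∀ {x y} → T (le x y) → r x ≡ r y → x ≡ y
  le∧rank≡⇒≡ {x} {y} x≤y rx≡ry with x ≟ᶠ y
  ... | yes x≡y = x≡y
  ... | no x≢y  = ⊥-elim (ℕ.<-irrefl rx≡ry (rank-< (from lt⇔ (x≤y , x≢y))))

  rank-≤ : ∀ {x y} → T (le x y) → r x ≤ r y
  rank-≤ {x} {y} x≤y with x ≟ᶠ y
  ... | yes refl = ℕ.≤-refl
  ... | no x≢y   = ℕ.<⇒≤ (rank-< (from lt⇔ (x≤y , x≢y)))

  covers⇔ : ∀ {x y} → Covers P x y ⇔ (T (lt P x y) × r y ≡ suc (r x))
  covers⇔ {x} {y} = mk⇔ (λ x⋖y → proj₁ (to (T-∧ {lt P x y}) x⋖y) , cover⇒suc x y x⋖y) cover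
    where
    cover : T (lt P x y) × r y ≡ suc (r x) → Covers P x y
    cover (x<y , ry≡1+rx) with covers-or-between x<y
    ... | inj₁ x⋖y = x⋖y
    ... | inj₂ (z , x<z , z<y) =
      ⊥-elim (ℕ.<⇒≱ (rank-< x<z) (ℕ.≤-pred (subst (suc (r z) ≤_) ry≡1+rx (rank-< z<y))))

  minimum-rank : ∀ {z} → IsMinimum z → r z ≡ 0
  minimum-rank {z} min = minimal⇒0 z (λ y y≤z → antisym y z y≤z (min y))

frac-1*frac : ∀ {p q} → 0 < p → 0 < q → frac 1 p * frac p q ≡ frac 1 q
frac-1*frac {suc a} {suc b} _ _ = ℚ.toℚᵘ-injective (begin
  toℚᵘ (frac 1 (suc a) * frac (suc a) (suc b))
    ≈⟨ ℚ.toℚᵘ-homo-* (frac 1 (suc a)) (frac (suc a) (suc b)) ⟩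
  toℚᵘ (frac 1 (suc a)) *ᵘ toℚᵘ (frac (suc a) (suc b))
    ≈⟨ ℚᵘ.*-cong (ℚ.toℚᵘ-fromℚᵘ (mkℚᵘ (+ 1) a)) (ℚ.toℚᵘ-fromℚᵘ (mkℚᵘ (+ suc a) b)) ⟩
  mkℚᵘ (+ 1) a *ᵘ mkℚᵘ (+ suc a) b
    ≈⟨ *≡* (ℤ.*-assoc (+ 1) (+ suc a) (+ suc b)) ⟩
  mkℚᵘ (+ 1) b
    ≈⟨ ℚᵘ.≃-sym (ℚ.toℚᵘ-fromℚᵘ (mkℚᵘ (+ 1) b)) ⟩
  toℚᵘ (frac 1 (suc b)) ∎)
  where open ℚᵘ.≃-Reasoning

module Extension {m} (P : FinPoset m) (r : Fin m → ℕ) (n : ℕ) (f : Fin m → Fin m → ℚ) where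
  open FinPoset P using (le)
  open Order P
  open Hat P r n f

  eqĤ⇒≡ : ∀ {a b} → T (eqĤ a b) → a ≡ b
  eqĤ⇒≡ {⊥̂}   {⊥̂}   _     = refl
  eqĤ⇒≡ {ι x} {ι y} x≈y = cong ι (toWitness x≈y)
  eqĤ⇒≡ {⊤̂}   {⊤̂}   _     = refl

  eqĤ-refl : ∀ a → T (eqĤ a a)
  eqĤ-refl ⊥̂     = tt
  eqĤ-refl (ι x) = fromWitness refl
  eqĤ-refl ⊤̂     = tt

  candidates : List (Ĥ m)
  candidates = ⊥̂ ∷ map ι (allFin m) ++ ⊤̂ ∷ []

  ∈-elemsP̂ : ∀ {a} → T (inP̂ a) → a ∈ elemsP̂
  ∈-elemsP̂ {a} a∈P̂ = ∈-filter⁺ (T? ∘ inP̂) (∈-candidates a) a∈P̂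
    where
    ∈-candidates : ∀ a → a ∈ candidates
    ∈-candidates ⊥̂     = here refl
    ∈-candidates (ι x) = there (∈-++⁺ˡ (∈-map⁺ ι (∈-allFin x)))
    ∈-candidates ⊤̂     = there (∈-++⁺ʳ (map ι (allFin m)) (here refl))

  elemsP̂⇒inP̂ : ∀ {a} → a ∈ elemsP̂ → T (inP̂ a)
  elemsP̂⇒inP̂ = proj₂ ∘ ∈-filter⁻ (T? ∘ inP̂) {xs = candidates}

  elemsP̂-unique : Unique elemsP̂
  elemsP̂-unique = Unique.filter⁺ (T? ∘ inP̂) {xs = candidates}
    (⊥̂∉ ∷ Unique.++⁺ (Unique.map⁺ ι-injective (Unique.allFin⁺ m)) (All.[] ∷ []) ι≢⊤̂)
    where
    ⊥̂∉ : All (⊥̂ ≢_) (map ι (allFin m) ++ ⊤̂ ∷ [])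
    ⊥̂∉ = Allₚ.++⁺ (Allₚ.map⁺ (All.universal (λ _ ()) _)) ((λ ()) ∷ All.[])
    ι-injective : ∀ {x y} → ι x ≡ ι y → x ≡ y
    ι-injective refl = refl
    ι≢⊤̂ : ∀ {c} → ¬ (c ∈ map ι (allFin m) × c ∈ ⊤̂ ∷ [])
    ι≢⊤̂ (c∈ι , here refl) with () ← proj₂ (∈-map⁻ ι c∈ι)

  ∑-elemsP̂-δ : ∀ {a} (g : Ĥ m → ℚ) → T (inP̂ a) → (∀ c → c ≢ a → g c ≡ 0ℚ) → ∑ elemsP̂ g ≡ g a
  ∑-elemsP̂-δ g a∈P̂ = ∑-δ g elemsP̂-unique (∈-elemsP̂ a∈P̂)

  ∑-elemsP̂-ι : ∀ (g : Ĥ m → ℚ) → g ⊥̂ ≡ 0ℚ → g ⊤̂ ≡ 0ℚ → ∑ elemsP̂ g ≡ ∑ (allFin m) (g ∘ ι)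
  ∑-elemsP̂-ι g g⊥̂≡0 g⊤̂≡0 = begin
    ∑ elemsP̂ g
      ≡⟨ ∑-filterᵇ candidates inP̂ g ⟩
    ∑ candidates (λ c → if inP̂ c then g c else 0ℚ)
      ≡⟨ ∑-cong candidates (λ {c} _ → outside-P̂ c) ⟩
    g ⊥̂ +ℚ ∑ (ιs ++ ⊤̂ ∷ []) g
      ≡⟨ cong₂ _+ℚ_ g⊥̂≡0 (∑-++ ιs (⊤̂ ∷ []) g) ⟩
    0ℚ +ℚ (∑ ιs g +ℚ (g ⊤̂ +ℚ 0ℚ))
      ≡⟨ cong (λ t → 0ℚ +ℚ (∑ ιs g +ℚ (t +ℚ 0ℚ))) g⊤̂≡0 ⟩
    0ℚ +ℚ (∑ ιs g +ℚ 0ℚ)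
      ≡⟨ trans (ℚ.+-identityˡ _) (ℚ.+-identityʳ _) ⟩
    ∑ ιs g
      ≡⟨ ∑-map (allFin m) ι g ⟩
    ∑ (allFin m) (g ∘ ι) ∎
    where
    open ≡-Reasoning
    ιs : List (Ĥ m)
    ιs = map ι (allFin m)
    outside-P̂ : ∀ c → (if inP̂ c then g c else 0ℚ) ≡ g c
    outside-P̂ ⊥̂     rewrite g⊥̂≡0 = if-eta hasNewBot
    outside-P̂ (ι x) = refl
    outside-P̂ ⊤̂     rewrite g⊤̂≡0 = if-eta hasNewTop

  step : Ĥ m → Ĥ m → Bool
  step c d = ltĤ c d ∧ (rk d ≡ᵇ suc (rk c))

  stepWeight : Ĥ m → Ĥ m → ℚ
  stepWeight c d = if step c d then f̂ c d else 0ℚ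

  steps : List (Ĥ m) → Bool
  steps (c ∷ d ∷ cs) = step c d ∧ steps (d ∷ cs)
  steps _            = true

  pathWeight : ℕ → Ĥ m → Ĥ m → ℚ
  pathWeight zero    a b = if eqĤ b a then 1ℚ else 0ℚ
  pathWeight (suc k) a b = ∑ elemsP̂ (λ c → stepWeight a c * pathWeight k c b)

  step⇒rk : ∀ {c d} → T (step c d) → rk d ≡ suc (rk c)
  step⇒rk {c} {d} c→d = ℕ.≡ᵇ⇒≡ _ _ (proj₂ (to (T-∧ {ltĤ c d}) c→d))

  pathWeight-vanishes : ∀ k a b → rk a + k ≢ rk b → pathWeight k a b ≡ 0ℚ
  pathWeight-vanishes zero a b a+0≢b =
    if-¬T (λ b≈a → a+0≢b (trans (ℕ.+-identityʳ _) (cong rk (sym (eqĤ⇒≡ b≈a)))))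
  pathWeight-vanishes (suc k) a b a+k+1≢b = ∑-zero elemsP̂ (λ {c} _ → term c)
    where
    term : ∀ c → stepWeight a c * pathWeight k c b ≡ 0ℚ
    term c with T? (step a c)
    ... | no ¬a→c = trans (cong (_* pathWeight k c b) (if-¬T ¬a→c)) (ℚ.*-zeroˡ (pathWeight k c b))
    ... | yes a→c = trans (cong (stepWeight a c *_) (pathWeight-vanishes k c b c+k≢b)) (ℚ.*-zeroʳ (stepWeight a c))
      where
      c+k≢b : rk c + k ≢ rk b
      c+k≢b c+k≡b = a+k+1≢b (trans (ℕ.+-suc (rk a) k) (trans (cong (_+ k) (sym (step⇒rk a→c))) c+k≡b))

  pathWeight-one : ∀ {a b} → T (inP̂ b) → pathWeight 1 a b ≡ stepWeight a b
  pathWeight-one {a} {b} b∈P̂ = begin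
    ∑ elemsP̂ (λ c → stepWeight a c * pathWeight 0 c b)
      ≡⟨ ∑-elemsP̂-δ (λ c → stepWeight a c * pathWeight 0 c b) b∈P̂
           (λ c c≢b → trans (cong (stepWeight a c *_) (if-¬T (c≢b ∘ sym ∘ eqĤ⇒≡))) (ℚ.*-zeroʳ (stepWeight a c))) ⟩
    stepWeight a b * pathWeight 0 b b
      ≡⟨ cong (stepWeight a b *_) (if-T (eqĤ-refl b)) ⟩
    stepWeight a b * 1ℚ
      ≡⟨ ℚ.*-identityʳ _ ⟩
    stepWeight a b ∎
    where open ≡-Reasoning

  pathWeight-snoc : ∀ k {a b} → T (inP̂ a) → T (inP̂ b) →
                    pathWeight (suc k) a b ≡ ∑ elemsP̂ (λ c → pathWeight k a c * stepWeight c b)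
  pathWeight-snoc zero {a} {b} a∈P̂ b∈P̂ = begin
    pathWeight 1 a b
      ≡⟨ pathWeight-one {a} b∈P̂ ⟩
    stepWeight a b
      ≡⟨ sym (ℚ.*-identityˡ (stepWeight a b)) ⟩
    1ℚ * stepWeight a b
      ≡⟨ cong (_* stepWeight a b) (sym (if-T (eqĤ-refl a))) ⟩
    pathWeight 0 a a * stepWeight a b
      ≡⟨ sym (∑-elemsP̂-δ (λ c → pathWeight 0 a c * stepWeight c b) a∈P̂
                (λ c c≢a → trans (cong (_* stepWeight c b) (if-¬T (c≢a ∘ eqĤ⇒≡))) (ℚ.*-zeroˡ (stepWeight c b)))) ⟩
    ∑ elemsP̂ (λ c → pathWeight 0 a c * stepWeight c b) ∎
    where open ≡-Reasoning
  pathWeight-snoc (suc k) {a} {b} a∈P̂ b∈P̂ = begin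
    ∑ P̂ (λ c → stepWeight a c * pathWeight (suc k) c b)
      ≡⟨ ∑-cong P̂ (λ c∈P̂ → cong (stepWeight a _ *_) (pathWeight-snoc k (elemsP̂⇒inP̂ c∈P̂) b∈P̂)) ⟩
    ∑ P̂ (λ c → stepWeight a c * ∑ P̂ (λ d → pathWeight k c d * stepWeight d b))
      ≡⟨ ∑-cong P̂ (λ {c} _ → *-distribˡ-∑ P̂ (stepWeight a c) _) ⟩
    ∑ P̂ (λ c → ∑ P̂ (λ d → stepWeight a c * (pathWeight k c d * stepWeight d b)))
      ≡⟨ ∑-comm P̂ P̂ _ ⟩
    ∑ P̂ (λ d → ∑ P̂ (λ c → stepWeight a c * (pathWeight k c d * stepWeight d b)))
      ≡⟨ ∑-cong P̂ (λ {d} _ → ∑-cong P̂ (λ {c} _ →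
           sym (ℚ.*-assoc (stepWeight a c) (pathWeight k c d) (stepWeight d b)))) ⟩
    ∑ P̂ (λ d → ∑ P̂ (λ c → (stepWeight a c * pathWeight k c d) * stepWeight d b))
      ≡⟨ ∑-cong P̂ (λ {d} _ → sym (*-distribʳ-∑ P̂ (stepWeight d b) _)) ⟩
    ∑ P̂ (λ d → pathWeight (suc k) a d * stepWeight d b) ∎
    where
    open ≡-Reasoning
    P̂ : List (Ĥ m)
    P̂ = elemsP̂

  stepChainWeight : Ĥ m → Ĥ m → List (Ĥ m) → ℚ
  stepChainWeight a b cs = if steps (a ∷ cs) ∧ lastIs b (a ∷ cs) then φC (a ∷ cs) else 0ℚ

  ∑-lists-suc : ∀ k (g : List (Ĥ m) → ℚ) →
                ∑ (lists (suc k)) g ≡ ∑ elemsP̂ (λ c → ∑ (lists k) (λ cs → g (c ∷ cs)))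
  ∑-lists-suc k g = trans (∑-concatMap elemsP̂ (λ c → map (c ∷_) (lists k)) g)
                          (∑-cong elemsP̂ (λ {c} _ → ∑-map (lists k) (c ∷_) g))

  ∑-stepChains : ∀ k a b → ∑ (lists k) (stepChainWeight a b) ≡ pathWeight k a b
  ∑-stepChains zero    a b = ℚ.+-identityʳ _
  ∑-stepChains (suc k) a b = begin
    ∑ (lists (suc k)) (stepChainWeight a b)
      ≡⟨ ∑-lists-suc k (stepChainWeight a b) ⟩
    ∑ elemsP̂ (λ c → ∑ (lists k) (λ cs → stepChainWeight a b (c ∷ cs)))
      ≡⟨ ∑-cong elemsP̂ (λ {c} _ → trans (∑-cong (lists k) (λ {cs} _ → first-step c cs))
                                         (sym (*-distribˡ-∑ (lists k) (stepWeight a c) _))) ⟩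
    ∑ elemsP̂ (λ c → stepWeight a c * ∑ (lists k) (stepChainWeight c b))
      ≡⟨ ∑-cong elemsP̂ (λ {c} _ → cong (stepWeight a c *_) (∑-stepChains k c b)) ⟩
    pathWeight (suc k) a b ∎
    where
    open ≡-Reasoning
    first-step : ∀ c cs → stepChainWeight a b (c ∷ cs) ≡ stepWeight a c * stepChainWeight c b cs
    first-step c cs = trans (cong (λ t → if t then f̂ a c * φC (c ∷ cs) else 0ℚ)
                                  (∧-assoc (step a c) (steps (c ∷ cs)) (lastIs b (c ∷ cs))))
                            (if-∧-* (step a c) _)

  data IsBottom : Ĥ m → Set where
    newBottom : T hasNewBot → IsBottom ⊥̂
    oldBottom : ∀ {z} → IsMinimum z → IsBottom (ι z)

  data IsTop : Ĥ m → Set where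
    newTop : T hasNewTop → IsTop ⊤̂
    oldTop : ∀ {z} → IsMaximum z → IsTop (ι z)

  found-extremum : ∀ {z} (rel : Fin m → Fin m → Bool) →
                   findᵇ (λ x → all (rel x) (allFin m)) (allFin m) ≡ just z → ∀ y → T (rel z y)
  found-extremum {z} rel found y =
    All.lookup (Allₚ.all⁺ (rel z) (allFin m) (findᵇ-just _ (allFin m) found)) (∈-allFin y)

  0̂-isBottom : IsBottom 0̂
  0̂-isBottom = view minimumP refl
    where
    view : ∀ o → minimumP ≡ o → IsBottom (maybe ι ⊥̂ o)
    view nothing  none  = newBottom (subst (T ∘ maybe (λ _ → false) true) (sym none) tt)
    view (just z) found = oldBottom (found-extremum le found)

  1̂-isTop : IsTop 1̂
  1̂-isTop = view maximumP refl
    where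
    view : ∀ o → maximumP ≡ o → IsTop (maybe ι ⊤̂ o)
    view nothing  none  = newTop (subst (T ∘ maybe (λ _ → false) true) (sym none) tt)
    view (just z) found = oldTop (found-extremum (λ x y → le y x) found)

  isBottom-inP̂ : ∀ {o} → IsBottom o → T (inP̂ o)
  isBottom-inP̂ (newBottom new) = new
  isBottom-inP̂ (oldBottom _)   = tt

  module Chains (graded : IsGraded P r) (bounded : ∀ x → r x < n) where
    open Graded P r graded
    open IsGraded graded using (cover⇒suc)

    rk≤ : ∀ c → rk c ≤ suc n
    rk≤ ⊥̂     = z≤n
    rk≤ (ι x) = ℕ.<⇒≤ (s≤s (bounded x))
    rk≤ ⊤̂     = ℕ.≤-refl

    ltĤ⇒rk< : ∀ {c d} → T (ltĤ c d) → rk c < rk d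
    ltĤ⇒rk< {⊥̂}   {ι y} _   = s≤s z≤n
    ltĤ⇒rk< {⊥̂}   {⊤̂}   _   = s≤s z≤n
    ltĤ⇒rk< {ι x} {ι y} x<y = s≤s (rank-< x<y)
    ltĤ⇒rk< {ι x} {⊤̂}   _   = s≤s (bounded x)
    ltĤ⇒rk< {⊥̂}   {⊥̂}   ()
    ltĤ⇒rk< {ι _} {⊥̂}   ()
    ltĤ⇒rk< {⊤̂}   {⊥̂}   ()
    ltĤ⇒rk< {⊤̂}   {ι _} ()
    ltĤ⇒rk< {⊤̂}   {⊤̂}   ()

    step-ι : ∀ x y → step (ι x) (ι y) ≡ coversB P x y
    step-ι x y = T-injective (begin
      T (lt P x y ∧ (suc (r y) ≡ᵇ suc (suc (r x))))  ≈⟨ T-∧ ⟩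
      (T (lt P x y) × T (r y ≡ᵇ suc (r x)))          ≈⟨ Equiv.refl ×-⇔ ≡ᵇ⇔≡ ⟩
      (T (lt P x y) × r y ≡ suc (r x))               ≈⟨ Equiv.sym covers⇔ ⟩
      Covers P x y                                   ∎)
      where open SetoidReasoning (Equiv.⇔-setoid 0ℓ)

    stepWeight-ι : ∀ x y → stepWeight (ι x) (ι y) ≡ (if coversB P x y then f x y else 0ℚ)
    stepWeight-ι x y = cong (λ b → if b then f x y else 0ℚ) (step-ι x y)

    Gapless : List (Ĥ m) → Set
    Gapless C = ∀ l → minLevel C ≤ l → l ≤ maxLevel C → Any (λ c → rk c ≡ l) C

    maxLevel≤ : ∀ C → maxLevel C ≤ suc n
    maxLevel≤ []      = z≤n
    maxLevel≤ (c ∷ C) = ℕ.⊔-lub (rk≤ c) (maxLevel≤ C)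

    skipless⇔gapless : ∀ C → T (skipless C) ⇔ Gapless C
    skipless⇔gapless C = mk⇔ gapless skipless′
      where
      inRange : ℕ → Bool
      inRange l = (minLevel C ≤ᵇ l) ∧ (l ≤ᵇ maxLevel C)
      hit : ℕ → Bool
      hit l = any (λ c → rk c ≡ᵇ l) C
      gapless : T (skipless C) → Gapless C
      gapless sk l min≤l l≤max =
        Any.map (ℕ.≡ᵇ⇒≡ _ _) (any⁻ _ C (to (T-not-∨ {inRange l}) checked (from T-∧ (ℕ.≤⇒≤ᵇ min≤l , ℕ.≤⇒≤ᵇ l≤max))))
        where
        checked : T (not (inRange l) ∨ hit l)
        checked = All.lookup (Allₚ.all⁺ (λ l → not (inRange l) ∨ hit l) (upTo (suc (suc n))) sk)
                             (∈-upTo⁺ (s≤s (ℕ.≤-trans l≤max (maxLevel≤ C))))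
      skipless′ : Gapless C → T (skipless C)
      skipless′ gl = Allₚ.all⁻ (λ l → not (inRange l) ∨ hit l) (All.universal checked (upTo (suc (suc n))))
        where
        checked : ∀ l → T (not (inRange l) ∨ hit l)
        checked l = from (T-not-∨ {inRange l}) λ l∈ →
          let min≤l , l≤max = to (T-∧ {minLevel C ≤ᵇ l}) l∈ in
          any⁺ _ (Any.map (ℕ.≡⇒≡ᵇ _ _) (gl l (ℕ.≤ᵇ⇒≤ _ _ min≤l) (ℕ.≤ᵇ⇒≤ _ _ l≤max)))

    minLevel-increasing : ∀ c cs → T (increasing (c ∷ cs)) → minLevel (c ∷ cs) ≡ rk c
    minLevel-increasing c []       _   = ℕ.m≤n⇒m⊓n≡m (ℕ.m≤n⇒m≤1+n (rk≤ c))
    minLevel-increasing c (d ∷ cs) inc =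
      let c<d , inc′ = to (T-∧ {ltĤ c d}) inc in
      trans (cong (rk c ⊓_) (minLevel-increasing d cs inc′)) (ℕ.m≤n⇒m⊓n≡m (ℕ.<⇒≤ (ltĤ⇒rk< c<d)))

    increasing-head-rk≤ : ∀ d cs {l} → T (increasing (d ∷ cs)) → Any (λ c → rk c ≡ l) (d ∷ cs) → rk d ≤ l
    increasing-head-rk≤ d cs       _   (here refl) = ℕ.≤-refl
    increasing-head-rk≤ d (e ∷ cs) inc (there e∈) =
      let d<e , inc′ = to (T-∧ {ltĤ d e}) inc in
      ℕ.≤-trans (ℕ.<⇒≤ (ltĤ⇒rk< d<e)) (increasing-head-rk≤ e cs inc′ e∈)

    gapless-∷∷ : ∀ {c d cs} → T (ltĤ c d) → T (increasing (d ∷ cs)) →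
                 Gapless (c ∷ d ∷ cs) ⇔ (rk d ≡ suc (rk c) × Gapless (d ∷ cs))
    gapless-∷∷ {c} {d} {cs} c<d inc = mk⇔
      (λ gl → adjacent gl , λ l d≤l l≤max → tail-hit gl l (subst (_≤ l) (min-d) d≤l) l≤max)
      (λ (d≡1+c , gl) l min≤l l≤max → extend d≡1+c gl l (subst (_≤ l) min-cd min≤l) l≤max)
      where
      rc<rd : rk c < rk d
      rc<rd = ltĤ⇒rk< c<d
      min-d : minLevel (d ∷ cs) ≡ rk d
      min-d = minLevel-increasing d cs inc
      min-cd : minLevel (c ∷ d ∷ cs) ≡ rk c
      min-cd = minLevel-increasing c (d ∷ cs) (from T-∧ (c<d , inc))
      max-cd : maxLevel (c ∷ d ∷ cs) ≡ maxLevel (d ∷ cs)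
      max-cd = ℕ.m≤n⇒m⊔n≡n (ℕ.≤-trans (ℕ.<⇒≤ rc<rd) (ℕ.m≤m⊔n (rk d) _))
      rd≤max : rk d ≤ maxLevel (d ∷ cs)
      rd≤max = ℕ.m≤m⊔n (rk d) _
      adjacent : Gapless (c ∷ d ∷ cs) → rk d ≡ suc (rk c)
      adjacent gl with gl (suc (rk c)) (subst (_≤ suc (rk c)) (sym min-cd) (ℕ.n≤1+n _))
                          (subst (suc (rk c) ≤_) (sym max-cd) (ℕ.≤-trans rc<rd rd≤max))
      ... | here rc≡1+rc = ⊥-elim (ℕ.1+n≢n (sym rc≡1+rc))
      ... | there hit    = ℕ.≤-antisym (increasing-head-rk≤ d cs inc hit) rc<rd
      tail-hit : Gapless (c ∷ d ∷ cs) → ∀ l → rk d ≤ l → l ≤ maxLevel (d ∷ cs) → Any (λ e → rk e ≡ l) (d ∷ cs)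
      tail-hit gl l d≤l l≤max with gl l (subst (_≤ l) (sym min-cd) (ℕ.<⇒≤ (ℕ.<-≤-trans rc<rd d≤l)))
                                        (subst (l ≤_) (sym max-cd) l≤max)
      ... | here refl = ⊥-elim (ℕ.<⇒≱ rc<rd d≤l)
      ... | there hit = hit
      extend : rk d ≡ suc (rk c) → Gapless (d ∷ cs) →
               ∀ l → rk c ≤ l → l ≤ maxLevel (c ∷ d ∷ cs) → Any (λ e → rk e ≡ l) (c ∷ d ∷ cs)
      extend d≡1+c gl l c≤l l≤max with rk c ℕ.≟ l
      ... | yes c≡l = here c≡l
      ... | no  c≢l = there (gl l (subst (_≤ l) (sym min-d) (subst (_≤ l) (sym d≡1+c) (ℕ.≤∧≢⇒< c≤l c≢l)))
                                  (subst (l ≤_) max-cd l≤max))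

    skipless-∷∷ : ∀ {c d cs} → T (ltĤ c d) → T (increasing (d ∷ cs)) →
                  skipless (c ∷ d ∷ cs) ≡ (rk d ≡ᵇ suc (rk c)) ∧ skipless (d ∷ cs)
    skipless-∷∷ {c} {d} {cs} c<d inc = T-injective (begin
      T (skipless (c ∷ d ∷ cs))                          ≈⟨ skipless⇔gapless _ ⟩
      Gapless (c ∷ d ∷ cs)                               ≈⟨ gapless-∷∷ c<d inc ⟩
      (rk d ≡ suc (rk c) × Gapless (d ∷ cs))             ≈⟨ Equiv.sym (≡ᵇ⇔≡ ×-⇔ skipless⇔gapless _) ⟩
      (T (rk d ≡ᵇ suc (rk c)) × T (skipless (d ∷ cs)))   ≈⟨ Equiv.sym T-∧ ⟩
      T ((rk d ≡ᵇ suc (rk c)) ∧ skipless (d ∷ cs))       ∎)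
      where open SetoidReasoning (Equiv.⇔-setoid 0ℓ)

    increasing∧skipless≡steps : ∀ c cs → increasing (c ∷ cs) ∧ skipless (c ∷ cs) ≡ steps (c ∷ cs)
    increasing∧skipless≡steps c [] = to T-≡ (from (skipless⇔gapless (c ∷ [])) single)
      where
      single : Gapless (c ∷ [])
      single l min≤l l≤max = here (ℕ.≤-antisym
        (subst (_≤ l) (minLevel-increasing c [] tt) min≤l) (subst (l ≤_) (ℕ.⊔-identityʳ (rk c)) l≤max))
    increasing∧skipless≡steps c (d ∷ cs)
      rewrite sym (increasing∧skipless≡steps d cs)
      with ltĤ c d in c<d | increasing (d ∷ cs) in inc
    ... | false | _     = refl
    ... | true  | false = sym (∧-zeroʳ _)
    ... | true  | true  = skipless-∷∷ {c} {d} {cs} (from T-≡ c<d) (from T-≡ inc)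

    inInterval : Ĥ m → Ĥ m → List (Ĥ m) → Bool
    inInterval a b C = increasing C ∧ skipless C ∧ headIs a C ∧ lastIs b C

    chainsOfLength : ℕ → Ĥ m → Ĥ m → ℚ
    chainsOfLength k a b = ∑ (lists k) (λ C → if inInterval a b C then φC C else 0ℚ)

    φ-by-length : ∀ a b → φ a b ≡ ∑ (upTo (suc (suc (suc m)))) (λ k → chainsOfLength k a b)
    φ-by-length a b =
      trans (∑-filterᵇ (concatMap lists (upTo (suc (suc (suc m))))) (inInterval a b) φC)
            (∑-concatMap (upTo (suc (suc (suc m)))) lists (λ C → if inInterval a b C then φC C else 0ℚ))

    chainsOfLength-zero : ∀ a b → chainsOfLength 0 a b ≡ 0ℚ
    chainsOfLength-zero a b rewrite ∧-zeroʳ (skipless []) = ℚ.+-identityʳ 0ℚ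

    chainsOfLength-suc : ∀ k {a} b → T (inP̂ a) → chainsOfLength (suc k) a b ≡ pathWeight k a b
    chainsOfLength-suc k {a} b a∈P̂ = begin
      chainsOfLength (suc k) a b
        ≡⟨ ∑-lists-suc k _ ⟩
      ∑ elemsP̂ (λ c → ∑ (lists k) (λ cs → if inInterval a b (c ∷ cs) then φC (c ∷ cs) else 0ℚ))
        ≡⟨ ∑-elemsP̂-δ _ a∈P̂ (λ c c≢a → ∑-zero (lists k) (λ {cs} _ →
             trans (split-head c cs) (if-¬T (c≢a ∘ sym ∘ eqĤ⇒≡)))) ⟩
      ∑ (lists k) (λ cs → if inInterval a b (a ∷ cs) then φC (a ∷ cs) else 0ℚ)
        ≡⟨ ∑-cong (lists k) (λ {cs} _ → trans (split-head a cs) (if-T (eqĤ-refl a))) ⟩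
      ∑ (lists k) (stepChainWeight a b)
        ≡⟨ ∑-stepChains k a b ⟩
      pathWeight k a b ∎
      where
      open ≡-Reasoning
      split-head : ∀ c cs → (if inInterval a b (c ∷ cs) then φC (c ∷ cs) else 0ℚ)
                       ≡ (if eqĤ a c then stepChainWeight c b cs else 0ℚ)
      split-head c cs = begin
        (if inInterval a b (c ∷ cs) then φC (c ∷ cs) else 0ℚ)
          ≡⟨ cong (λ t → if t then φC (c ∷ cs) else 0ℚ) (∧-pull (increasing (c ∷ cs)) _ (eqĤ a c) _) ⟩
        (if eqĤ a c ∧ ((increasing (c ∷ cs) ∧ skipless (c ∷ cs)) ∧ lastIs b (c ∷ cs)) then φC (c ∷ cs) else 0ℚ)
          ≡⟨ cong (λ t → if eqĤ a c ∧ (t ∧ lastIs b (c ∷ cs)) then φC (c ∷ cs) else 0ℚ)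
                  (increasing∧skipless≡steps c cs) ⟩
        (if eqĤ a c ∧ (steps (c ∷ cs) ∧ lastIs b (c ∷ cs)) then φC (c ∷ cs) else 0ℚ)
          ≡⟨ if-∧ (eqĤ a c) ⟩
        (if eqĤ a c then stepChainWeight c b cs else 0ℚ) ∎

    -- Only chains with rk b ∸ rk a + 1 elements contribute; n ≤ m keeps that length inside the
    -- range enumerated by interval.
    φ≡pathWeight : n ≤ m → ∀ {a b} → T (inP̂ a) → rk a ≤ rk b → φ a b ≡ pathWeight (rk b ∸ rk a) a b
    φ≡pathWeight n≤m {a} {b} a∈P̂ a≤b = begin
      φ a b
        ≡⟨ φ-by-length a b ⟩
      ∑ (upTo (suc (suc (suc m)))) (λ k → chainsOfLength k a b)
        ≡⟨ ∑-δ (λ k → chainsOfLength k a b) (Unique.upTo⁺ _) (∈-upTo⁺ (s≤s (s≤s length≤))) other-lengths ⟩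
      chainsOfLength (suc (rk b ∸ rk a)) a b
        ≡⟨ chainsOfLength-suc (rk b ∸ rk a) b a∈P̂ ⟩
      pathWeight (rk b ∸ rk a) a b ∎
      where
      open ≡-Reasoning
      length≤ : rk b ∸ rk a ≤ suc m
      length≤ = ℕ.≤-trans (ℕ.m∸n≤m (rk b) (rk a)) (ℕ.≤-trans (rk≤ b) (s≤s n≤m))
      other-lengths : ∀ k → k ≢ suc (rk b ∸ rk a) → chainsOfLength k a b ≡ 0ℚ
      other-lengths zero    _  = chainsOfLength-zero a b
      other-lengths (suc k) k≢ = trans (chainsOfLength-suc k b a∈P̂) (pathWeight-vanishes k a b
        (λ a+k≡b → k≢ (cong suc (ℕ.+-cancelˡ-≡ (rk a) k _ (trans a+k≡b (sym (ℕ.m+[n∸m]≡n a≤b)))))))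

    isBottom-rk≤1 : ∀ {o} → IsBottom o → rk o ≤ 1
    isBottom-rk≤1 (newBottom _)   = z≤n
    isBottom-rk≤1 (oldBottom min) = s≤s (ℕ.≤-reflexive (minimum-rank min))

    isTop-rk≥ : ∀ {t} → IsTop t → ∀ x → rk (ι x) ≤ rk t
    isTop-rk≥ (newTop _)   x = s≤s (ℕ.<⇒≤ (bounded x))
    isTop-rk≥ (oldTop max) x = s≤s (rank-≤ (max x))

    module Flow (levels : ∀ i → i < n → ∃ λ x → r x ≡ i) (snmf : IsSNMF P r n f) where
      open IsSNMF snmf
      open Levels P r

      pathWeight-from-bottom-step : ∀ {o k i y} → T (inP̂ o) → r y ≡ suc i →
                                    (∀ x → r x ≡ i → pathWeight k o (ι x) ≡ frac 1 (N P r i)) →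
                                    pathWeight (suc k) o (ι y) ≡ frac 1 (N P r (suc i))
      pathWeight-from-bottom-step {o} {k} {i} {y} o∈P̂ ry≡1+i below = begin
        pathWeight (suc k) o (ι y)
          ≡⟨ pathWeight-snoc k o∈P̂ tt ⟩
        ∑ elemsP̂ (λ c → pathWeight k o c * stepWeight c (ι y))
          ≡⟨ ∑-elemsP̂-ι _ (trans (cong (pathWeight k o ⊥̂ *_) ⊥̂↛y) (ℚ.*-zeroʳ (pathWeight k o ⊥̂)))
                          (ℚ.*-zeroʳ (pathWeight k o ⊤̂)) ⟩
        ∑ (allFin m) (λ x → pathWeight k o (ι x) * stepWeight (ι x) (ι y))
          ≡⟨ ∑-cong (allFin m) (λ {x} _ → trans (cong (pathWeight k o (ι x) *_) (stepWeight-ι x y)) (through x)) ⟩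
        ∑ (allFin m) (λ x → 1/Nᵢ * (if coversB P x y then f x y else 0ℚ))
          ≡⟨ sym (*-distribˡ-∑ (allFin m) 1/Nᵢ _) ⟩
        1/Nᵢ * ∑ (allFin m) (λ x → if coversB P x y then f x y else 0ℚ)
          ≡⟨ cong (1/Nᵢ *_) (sym (∑-filterᵇ (allFin m) (λ x → coversB P x y) (λ x → f x y))) ⟩
        1/Nᵢ * ∑ (filterᵇ (λ x → coversB P x y) (allFin m)) (λ x → f x y)
          ≡⟨ cong (1/Nᵢ *_) (down i y i+2≤n ry≡1+i) ⟩
        1/Nᵢ * frac (N P r i) (N P r (suc i))
          ≡⟨ frac-1*frac (N-pos (proj₂ (levels i (ℕ.<-trans (ℕ.n<1+n i) i+2≤n))))
                         (N-pos (proj₂ (levels (suc i) i+2≤n))) ⟩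
        frac 1 (N P r (suc i)) ∎
        where
        open ≡-Reasoning
        1/Nᵢ : ℚ
        1/Nᵢ = frac 1 (N P r i)
        i+2≤n : suc (suc i) ≤ n
        i+2≤n = subst (_< n) ry≡1+i (bounded y)
        ⊥̂↛y : stepWeight ⊥̂ (ι y) ≡ 0ℚ
        ⊥̂↛y rewrite ry≡1+i = refl
        through : ∀ x → pathWeight k o (ι x) * (if coversB P x y then f x y else 0ℚ)
                        ≡ 1/Nᵢ * (if coversB P x y then f x y else 0ℚ)
        through x with coversB P x y in x⋖y
        ... | true  = cong (_* f x y)
                           (below x (ℕ.suc-injective (trans (sym (cover⇒suc x y (from T-≡ x⋖y))) ry≡1+i)))
        ... | false = trans (ℚ.*-zeroʳ (pathWeight k o (ι x))) (sym (ℚ.*-zeroʳ 1/Nᵢ))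

      pathWeight-to-top-step : ∀ {k t x} → suc (suc (r x)) ≤ n →
                               (∀ y → r y ≡ suc (r x) → pathWeight k (ι y) t ≡ 1ℚ) →
                               pathWeight (suc k) (ι x) t ≡ 1ℚ
      pathWeight-to-top-step {k} {t} {x} x+2≤n above = begin
        pathWeight (suc k) (ι x) t
          ≡⟨ ∑-elemsP̂-ι _ (ℚ.*-zeroˡ (pathWeight k ⊥̂ t))
                          (trans (cong (_* pathWeight k ⊤̂ t) x↛⊤̂) (ℚ.*-zeroˡ (pathWeight k ⊤̂ t))) ⟩
        ∑ (allFin m) (λ y → stepWeight (ι x) (ι y) * pathWeight k (ι y) t)
          ≡⟨ ∑-cong (allFin m) (λ {y} _ → trans (cong (_* pathWeight k (ι y) t) (stepWeight-ι x y)) (through y)) ⟩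
        ∑ (allFin m) (λ y → if coversB P x y then f x y else 0ℚ)
          ≡⟨ sym (∑-filterᵇ (allFin m) (coversB P x) (f x)) ⟩
        ∑ (filterᵇ (coversB P x) (allFin m)) (f x)
          ≡⟨ up (r x) x x+2≤n refl ⟩
        1ℚ ∎
        where
        open ≡-Reasoning
        x↛⊤̂ : stepWeight (ι x) ⊤̂ ≡ 0ℚ
        x↛⊤̂ = if-¬T {b = step (ι x) ⊤̂}
                 (λ x→⊤̂ → ℕ.<-irrefl (sym (ℕ.suc-injective (step⇒rk {ι x} {⊤̂} x→⊤̂))) x+2≤n)
        through : ∀ y → (if coversB P x y then f x y else 0ℚ) * pathWeight k (ι y) t
                        ≡ (if coversB P x y then f x y else 0ℚ)
        through y with coversB P x y in x⋖y
        ... | true  = trans (cong (f x y *_) (above y (cover⇒suc x y (from T-≡ x⋖y)))) (ℚ.*-identityʳ (f x y))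
        ... | false = ℚ.*-zeroˡ (pathWeight k (ι y) t)

      pathWeight-from-bottom : ∀ {o} → IsBottom o → ∀ i y → r y ≡ i →
                               pathWeight (suc i ∸ rk o) o (ι y) ≡ frac 1 (N P r i)
      pathWeight-from-bottom (newBottom _) zero y ry≡0 =
        trans (pathWeight-one {⊥̂} {ι y} tt) (if-T {b = step ⊥̂ (ι y)} (ℕ.≡⇒≡ᵇ (r y) 0 ry≡0))
      pathWeight-from-bottom (oldBottom {z} min) zero y ry≡0 = begin
        pathWeight (1 ∸ suc (r z)) (ι z) (ι y)  ≡⟨ cong (λ l → pathWeight (1 ∸ suc l) (ι z) (ι y)) rz≡0 ⟩
        pathWeight 0 (ι z) (ι y)                ≡⟨ if-T {b = eqĤ (ι y) (ι z)} (fromWitness (only-z y ry≡0)) ⟩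
        1ℚ                                      ≡⟨ cong (frac 1) (sym (N≡1 rz≡0 only-z)) ⟩
        frac 1 (N P r 0)                        ∎
        where
        open ≡-Reasoning
        rz≡0 : r z ≡ 0
        rz≡0 = minimum-rank min
        only-z : ∀ y → r y ≡ 0 → y ≡ z
        only-z y ry≡0 = sym (le∧rank≡⇒≡ (min y) (trans rz≡0 (sym ry≡0)))
      pathWeight-from-bottom {o} b (suc i) y ry≡1+i =
        trans (cong (λ k → pathWeight k o (ι y)) (ℕ.+-∸-assoc 1 (ℕ.≤-trans (isBottom-rk≤1 b) (s≤s z≤n))))
              (pathWeight-from-bottom-step {k = suc i ∸ rk o} (isBottom-inP̂ b) ry≡1+i
                                           (λ x rx≡i → pathWeight-from-bottom b i x rx≡i))

      pathWeight-from-top-level : ∀ {t k x} → IsTop t → suc (r x) ≡ n → suc (r x) + suc k ≡ rk t →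
                                  pathWeight (suc k) (ι x) t ≡ 1ℚ
      pathWeight-from-top-level {k = zero} {x} (newTop new) x+1≡n _ =
        trans (pathWeight-one {ι x} {⊤̂} new) (if-T {b = step (ι x) ⊤̂} (ℕ.≡⇒≡ᵇ n (suc (r x)) (sym x+1≡n)))
      pathWeight-from-top-level {k = suc k} {x} (newTop _) x+1≡n e =
        ⊥-elim (ℕ.1+n≢0 (ℕ.suc-injective (ℕ.+-cancelˡ-≡ (suc (r x)) (suc (suc k)) 1
          (trans e (trans (cong suc (sym x+1≡n)) (ℕ.+-comm 1 (suc (r x))))))))
      pathWeight-from-top-level {x = x} (oldTop {z} _) x+1≡n e = ⊥-elim (ℕ.<⇒≱
        (subst (suc (r x) <_) e (ℕ.m<m+n (suc (r x)) (s≤s z≤n)))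
        (subst (suc (r z) ≤_) (sym x+1≡n) (bounded z)))

      pathWeight-to-top : ∀ {t} → IsTop t → ∀ k x → suc (r x) + k ≡ rk t → pathWeight k (ι x) t ≡ 1ℚ
      pathWeight-to-top (newTop _) zero x x+1≡n+1 =
        ⊥-elim (ℕ.<-irrefl (ℕ.suc-injective (trans (sym (ℕ.+-identityʳ _)) x+1≡n+1)) (bounded x))
      pathWeight-to-top (oldTop {z} max) zero x x+1≡z+1 = if-T {b = eqĤ (ι z) (ι x)}
        (fromWitness (sym (le∧rank≡⇒≡ (max x) (ℕ.suc-injective (trans (sym (ℕ.+-identityʳ _)) x+1≡z+1)))))
      pathWeight-to-top {t} top (suc k) x e with suc (suc (r x)) ℕ.≤? n
      ... | yes x+2≤n = pathWeight-to-top-step {k} {t} x+2≤n λ y ry≡1+rx →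
                          pathWeight-to-top top k y
                            (trans (cong (λ l → suc l + k) ry≡1+rx) (trans (sym (ℕ.+-suc (suc (r x)) k)) e))
      ... | no  x+2≰n = pathWeight-from-top-level top (ℕ.≤-antisym (bounded x) (ℕ.≮⇒≥ x+2≰n)) e

      φ-from-0̂ : ∀ x → φ 0̂ (ι x) ≡ frac 1 (N P r (r x))
      φ-from-0̂ x = trans (φ≡pathWeight (levels⇒n≤m levels) (isBottom-inP̂ 0̂-isBottom)
                                        (ℕ.≤-trans (isBottom-rk≤1 0̂-isBottom) (s≤s z≤n)))
                         (pathWeight-from-bottom 0̂-isBottom (r x) x refl)

      φ-to-1̂ : ∀ x → φ (ι x) 1̂ ≡ 1ℚ
      φ-to-1̂ x = trans (φ≡pathWeight (levels⇒n≤m levels) tt (isTop-rk≥ 1̂-isTop x))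
                       (pathWeight-to-top 1̂-isTop _ x (ℕ.m+[n∸m]≡n (isTop-rk≥ 1̂-isTop x)))

-- The hypothesis i < n is redundant given r x < n.
lemma5p1 : ∀ {m : ℕ} (P : FinPoset m) (r : Fin m → ℕ) (n : ℕ) →
    IsGraded P r →
    (∀ x → r x < n) →
    (∀ i → i < n → ∃ λ x → r x ≡ i) →
    (f : Fin m → Fin m → ℚ) → IsSNMF P r n f →
    ∀ (i : ℕ) (x : Fin m) → i < n → r x ≡ i →
      (Hat.φ P r n f (Hat.0̂ P r n f) (ι x) ≡ frac 1 (N P r i))
      × (Hat.φ P r n f (ι x) (Hat.1̂ P r n f) ≡ 1ℚ)
lemma5p1 P r n graded bounded levels f snmf i x _ refl = φ-from-0̂ x , φ-to-1̂ x
  where open Extension.Chains.Flow P r n f graded bounded levels snmf
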